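{- For all natural numbers $m\ge1$, $a\ge1$ and $x>0$, $$h_{\omega^2\cdot 2am}(x)\ge\underbrace{\mathrm{tow}_a(\cdots(\mathrm{tow}_a}_{m\text{ times}}(x+1))\cdots).$$
   Context: $\mathrm{tow}_0(x)=1$, $\mathrm{tow}_{n+1}(x)=x^{\mathrm{tow}_n(x)}$. Fundamental sequences below $\varepsilon_0$ (Cantor normal form): $\omega[n]=n$, $(\omega^{\beta+1})[n]=\omega^\beta\cdot n$, $(\omega^\psi)[n]=\omega^{\psi[n]}$ for $\psi$ limit, and for $\lambda=\gamma+\omega^\beta$ in Cantor normal form with $\gamma\neq0$, $\lambda[n]=\gamma+(\omega^\beta)[n]$. Hardy hierarchy based on $h(x)=x+1$: $h_0(x)=x$, $h_{\alpha+1}(x)=h_\alpha(x+1)$, $h_\lambda(x)=h_{\lambda[x]}(x)$ for limit $\lambda$. -}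

module Defs where

open import Data.Nat using (ℕ; zero; suc; _^_)
open import Relation.Binary.PropositionalEquality using (_≡_)

-- Ordinal terms below ε₀ in Cantor normal form:
-- 𝟎 is zero, and  ω^ a + b  denotes  ω^a + b  (b the remaining CNF terms).
data Ord : Set where
  𝟎    : Ord
  ω^_+_ : Ord → Ord → Ord

ω^_·_ : Ord → ℕ → Ord
ω^ a · zero  = 𝟎
ω^ a · suc n = ω^ a + (ω^ a · n)

fin : ℕ → Ord
fin n = ω^ 𝟎 · n

data Shape : Set where
  isZero : Shape
  isSucc : Ord → Shape
  isLim  : (ℕ → Ord) → Shape

-- Fundamental sequences as in the paper:
--   ω^(β+1)[n] = ω^β · n,  ω^ψ[n] = ω^(ψ[n]) (ψ limit),
--   (γ + ω^β)[n] = γ + (ω^β)[n]   (γ ≠ 0).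
-- Successors: (γ + ω^0) = γ + 1 has predecessor γ.
shape : Ord → Shape
shape 𝟎 = isZero
shape (ω^ a + 𝟎) with shape a
... | isZero   = isSucc 𝟎
... | isSucc p = isLim (λ n → ω^ p · n)
... | isLim f  = isLim (λ n → ω^ (f n) + 𝟎)
shape (ω^ a + (ω^ b + c)) with shape (ω^ b + c)
... | isZero   = isZero   -- unreachable: a nonzero term is never zero
... | isSucc p = isSucc (ω^ a + p)
... | isLim f  = isLim (λ n → ω^ a + f n)

-- Graph of the Hardy hierarchy h_α(x) based on h(x) = x + 1:
--   h_0(x) = x,  h_{α+1}(x) = h_α(x+1),  h_λ(x) = h_{λ[x]}(x).
-- Hardy α x y  means  h_α(x) = y.
data Hardy : Ord → ℕ → ℕ → Set where
  h-zero : ∀ {α x} → shape α ≡ isZero → Hardy α x x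
  h-succ : ∀ {α β x y} → shape α ≡ isSucc β → Hardy β (suc x) y → Hardy α x y
  h-lim  : ∀ {α f x y} → shape α ≡ isLim f → Hardy (f x) x y → Hardy α x y

tow : ℕ → ℕ → ℕ
tow zero    x = 1
tow (suc n) x = x ^ tow n x

iter : ℕ → (ℕ → ℕ) → ℕ → ℕ
iter zero    f x = x
iter (suc m) f x = f (iter m f x)

module Submission where

-- The Hardy hierarchy is "additive along Cantor normal form":
-- h_{ω^a + γ}(x) = h_{ω^a}(h_γ(x)), hence h_{ω^α·k} is the k-fold iterate of
-- h_{ω^α}.  Climbing three levels gives h_1(y) = y + 1, h_ω(y) = 2y and
-- h_{ω²}(y) = G(y) := 2^y · y, so h_{ω²·N}(x) = G^N(x).
-- The arithmetic half compares towers with iterates of G: the estimate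
-- (x+1)^y ≤ G(G(y)) for 1 ≤ y, x ≤ y yields tow_a(x+1) ≤ G^{2a}(x) for
-- x ≥ 1 by induction on a.  A general domination principle for iterates
-- (if f(z+1) ≤ g(z) and g is inflationary, then f^m(x+1) ≤ g^m(x)) applied
-- with f = tow_a and g = G^{2a} gives tow_a^m(x+1) ≤ G^{2am}(x).

open import Defs
open import Data.Nat using (ℕ; suc; zero; _+_; _*_; _^_; _≤_; _<_; z≤n; s≤s; >-nonZero)
open import Data.Nat.Properties
open import Data.Product using (Σ; _×_; _,_)
open import Relation.Binary.PropositionalEquality

cnf-nonzero : ∀ b e → shape (ω^ b + e) ≢ isZero
cnf-nonzero b 𝟎 with shape b
... | isZero   = λ ()
... | isSucc _ = λ ()
... | isLim _  = λ ()
cnf-nonzero b (ω^ c + d) with shape (ω^ c + d) in eq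
... | isZero   = λ _ → cnf-nonzero c d eq
... | isSucc _ = λ ()
... | isLim _  = λ ()

shape-cons-succ : ∀ {a γ β} → shape γ ≡ isSucc β → shape (ω^ a + γ) ≡ isSucc (ω^ a + β)
shape-cons-succ {γ = 𝟎} ()
shape-cons-succ {γ = ω^ b + e} eq rewrite eq = refl

shape-cons-lim : ∀ {a γ f} → shape γ ≡ isLim f → shape (ω^ a + γ) ≡ isLim (λ n → ω^ a + f n)
shape-cons-lim {γ = 𝟎} ()
shape-cons-lim {γ = ω^ b + e} eq rewrite eq = refl

hardy-cons : ∀ {a γ x y z} → Hardy γ x y → Hardy (ω^ a + 𝟎) y z → Hardy (ω^ a + γ) x z
hardy-cons {γ = 𝟎} (h-zero _) k = k
hardy-cons {γ = 𝟎} (h-succ () _) k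
hardy-cons {γ = 𝟎} (h-lim () _) k
hardy-cons {γ = ω^ b + e} (h-zero eq) k with () ← cnf-nonzero b e eq
hardy-cons {a = a} {γ = γ@(ω^ _ + _)} (h-succ eq d) k =
  h-succ (shape-cons-succ {a = a} {γ = γ} eq) (hardy-cons d k)
hardy-cons {a = a} {γ = γ@(ω^ _ + _)} (h-lim eq d) k =
  h-lim (shape-cons-lim {a = a} {γ = γ} eq) (hardy-cons d k)

hardy-iter : ∀ {α F} → (∀ y → Hardy (ω^ α + 𝟎) y (F y)) →
             ∀ k x → Hardy (ω^ α · k) x (iter k F x)
hardy-iter h zero    x = h-zero refl
hardy-iter h (suc k) x = hardy-cons (hardy-iter h k x) (h _)

iter-suc : ∀ n y → iter n suc y ≡ n + y
iter-suc zero    y = refl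
iter-suc (suc n) y = cong suc (iter-suc n y)

iter-double : ∀ n y → iter n (2 *_) y ≡ 2 ^ n * y
iter-double zero    y = sym (+-identityʳ y)
iter-double (suc n) y = trans (cong (2 *_) (iter-double n y)) (sym (*-assoc 2 (2 ^ n) y))

hardy-one : ∀ y → Hardy (ω^ 𝟎 + 𝟎) y (suc y)
hardy-one y = h-succ refl (h-zero refl)

hardy-ω : ∀ y → Hardy (ω^ (fin 1) + 𝟎) y (2 * y)
hardy-ω y = h-lim refl (subst (Hardy (fin y) y) y+y≡2y (hardy-iter hardy-one y y))
  where
  y+y≡2y : iter y suc y ≡ 2 * y
  y+y≡2y = trans (iter-suc y y) (cong (y +_) (sym (+-identityʳ y)))

G : ℕ → ℕ
G y = 2 ^ y * y

hardy-ω² : ∀ y → Hardy (ω^ (fin 2) + 𝟎) y (G y)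
hardy-ω² y = h-lim refl (subst (Hardy (ω^ (fin 1) · y) y) (iter-double y y) (hardy-iter hardy-ω y y))

iter-+ : ∀ (f : ℕ → ℕ) p q x → iter (p + q) f x ≡ iter p f (iter q f x)
iter-+ f zero    q x = refl
iter-+ f (suc p) q x = cong f (iter-+ f p q x)

iter-iter : ∀ (f : ℕ → ℕ) p n x → iter n (iter p f) x ≡ iter (p * n) f x
iter-iter f p zero    x = cong (λ k → iter k f x) (sym (*-zeroʳ p))
iter-iter f p (suc n) x = begin
  iter p f (iter n (iter p f) x) ≡⟨ cong (iter p f) (iter-iter f p n x) ⟩
  iter p f (iter (p * n) f x)    ≡⟨ sym (iter-+ f p (p * n) x) ⟩
  iter (p + p * n) f x           ≡⟨ cong (λ k → iter k f x) (sym (*-suc p n)) ⟩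
  iter (p * suc n) f x           ∎
  where open ≡-Reasoning

iter-inflationary : ∀ {f : ℕ → ℕ} → (∀ z → z ≤ f z) → ∀ n x → x ≤ iter n f x
iter-inflationary infl zero    x = ≤-refl
iter-inflationary infl (suc n) x = ≤-trans (iter-inflationary infl n x) (infl _)

iter-positive : ∀ {f : ℕ → ℕ} → (∀ u → 1 ≤ u → 1 ≤ f u) → ∀ n x → 1 ≤ x → 1 ≤ iter n f x
iter-positive pos zero    x p = p
iter-positive pos (suc n) x p = pos _ (iter-positive pos n x p)

iter-dominate : ∀ (f g : ℕ → ℕ) →
  (∀ {u v} → 1 ≤ u → u ≤ v → f u ≤ f v) → (∀ u → 1 ≤ u → 1 ≤ f u) →
  (∀ z → 1 ≤ z → f (suc z) ≤ g z) → (∀ z → z ≤ g z) →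
  ∀ k x → 1 ≤ x → iter (suc k) f (suc x) ≤ iter (suc k) g x
iter-dominate f g mono pos step infl zero    x p = step x p
iter-dominate f g mono pos step infl (suc k) x p =
  ≤-trans (mono (iter-positive pos (suc k) (suc x) (s≤s z≤n))
                (m≤n⇒m≤1+n (iter-dominate f g mono pos step infl k x p)))
          (step _ (iter-positive (λ u q → ≤-trans q (infl u)) (suc k) x p))

n<2^n : ∀ n → n < 2 ^ n
n<2^n zero    = ≤-refl
n<2^n (suc n) = ≤-<-trans (n<2^n n) (m<m+n (2 ^ n) (≤-trans (m^n>0 2 n) (m≤m+n (2 ^ n) 0)))

G-inflationary : ∀ y → y ≤ G y
G-inflationary y = m≤n*m y (2 ^ y) {{m^n≢0 2 y}}

power-below-GG : ∀ {x y} → x ≤ y → 1 ≤ y → suc x ^ y ≤ G (G y)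
power-below-GG {x} {y} x≤y 1≤y = begin
  suc x ^ y         ≤⟨ ^-monoˡ-≤ y (≤-trans (s≤s x≤y) base≤) ⟩
  (2 ^ (2 ^ y)) ^ y ≡⟨ ^-*-assoc 2 (2 ^ y) y ⟩
  2 ^ G y           ≤⟨ m≤m*n (2 ^ G y) (G y) {{>-nonZero (≤-trans 1≤y (G-inflationary y))}} ⟩
  G (G y)           ∎
  where
  open ≤-Reasoning
  base≤ : suc y ≤ 2 ^ (2 ^ y)
  base≤ = ≤-trans (n<2^n y) (^-monoʳ-≤ 2 (<⇒≤ (n<2^n y)))

tow-positive : ∀ a u → 1 ≤ u → 1 ≤ tow a u
tow-positive zero    u       p = ≤-refl
tow-positive (suc a) (suc u) p = m^n>0 (suc u) (tow a (suc u))

tow-mono : ∀ a {u v} → 1 ≤ u → u ≤ v → tow a u ≤ tow a v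
tow-mono zero    p q = ≤-refl
tow-mono (suc a) {suc u} {v} p q =
  ≤-trans (^-monoʳ-≤ (suc u) (tow-mono a p q)) (^-monoˡ-≤ (tow a v) q)

-- Writing y = G^{2a}(x), we have tow_a(x+1) ≤ y and x ≤ y, so
-- tow_{a+1}(x+1) = (x+1)^{tow_a(x+1)} ≤ (x+1)^y ≤ G(G y) = G^{2(a+1)}(x).
tow-below-iterG : ∀ a x → 1 ≤ x → tow a (suc x) ≤ iter (2 * a) G x
tow-below-iterG zero    x p = p
tow-below-iterG (suc a) x p = begin
  suc x ^ tow a (suc x) ≤⟨ ^-monoʳ-≤ (suc x) (tow-below-iterG a x p) ⟩
  suc x ^ y             ≤⟨ power-below-GG x≤y (≤-trans p x≤y) ⟩
  G (G y)               ≡⟨ cong (λ n → iter n G x) (sym (*-suc 2 a)) ⟩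
  iter (2 * suc a) G x  ∎
  where
  open ≤-Reasoning
  y : ℕ
  y = iter (2 * a) G x
  x≤y : x ≤ y
  x≤y = iter-inflationary G-inflationary (2 * a) x

mainTheorem8 : (m a x : ℕ) → 1 ≤ m → 1 ≤ a → 0 < x →
    Σ ℕ (λ y → Hardy (ω^ (fin 2) · (2 * a * m)) x y × iter m (tow a) (suc x) ≤ y)
mainTheorem8 (suc k) a x _ _ 1≤x =
  iter (2 * a * suc k) G x , hardy-iter hardy-ω² (2 * a * suc k) x , towers≤iterG
  where
  open ≤-Reasoning
  towers≤iterG : iter (suc k) (tow a) (suc x) ≤ iter (2 * a * suc k) G x
  towers≤iterG = begin
    iter (suc k) (tow a) (suc x)        ≤⟨ iter-dominate (tow a) (iter (2 * a) G)
                                             (tow-mono a) (tow-positive a) (tow-below-iterG a)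
                                             (iter-inflationary G-inflationary (2 * a)) k x 1≤x ⟩
    iter (suc k) (iter (2 * a) G) x     ≡⟨ iter-iter G (2 * a) (suc k) x ⟩
    iter (2 * a * suc k) G x            ∎
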